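{- Let $\mathcal{G}=(V,\{E_1,\dots,E_\tau\})$ be any multi-layer graph and let $\mathcal{G}'=(V,\{E_1,\dots,E_\tau\},\binom{V}{2})$ be the multi-layer graph with cop layers $E_1,\dots,E_\tau$ and robber layer $\binom V2$. Then the multi-layer cop number of $\mathcal{G}'$ is at most $\gamma(\mathcal{G})$.
   Context: A multi-layer graph $(V,\{E_1,\dots,E_\tau\})$ has finite vertex set $V$ and layers $E_i\subseteq\binom V2$. A multi-layer dominating set is a set $D\subseteq V\times\{1,\dots,\tau\}$ such that for every $v\in V$ either $(v,i)\in D$ for some $i$, or there is $(w,i)\in D$ with $vw\in E_i$; $\gamma(\mathcal G)$ is the minimum size of a multi-layer dominating set. Game on $(V,\{C_1,\dots,C_\tau\},R)$ with allocation $(k_1,\dots,k_\tau)$: $k_i$ cops assigned to layer $C_i$; cops are placed first, then the robber; turns alternate starting with the cops; each cop stays or moves along one edge of its own layer, the robber stays or moves along one edge of $R$; cops win if a cop ever occupies the robber's vertex. The multi-layer cop number is the least $k$ such that some allocation with $\sum_ik_i=k$ gives the cop player a winning strategy. -}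

module Defs where

open import Data.Nat using (ℕ; zero; suc; _+_; _≤_)
open import Data.Fin using (Fin; toℕ) renaming (zero to fzero; suc to fsuc)
open import Data.Product using (Σ; ∃; ∃-syntax; _×_; _,_)
open import Data.Sum using (_⊎_)
open import Data.List using (List; length)
open import Data.List.Membership.Propositional using (_∈_)
open import Data.List.Relation.Unary.Unique.Propositional using (Unique)
open import Relation.Binary.PropositionalEquality using (_≡_; _≢_; refl) renaming (sym to ≡-sym)
open import Relation.Nullary using (¬_)

record MLGraph (n τ : ℕ) : Set₁ where
  field
    Adj    : Fin τ → Fin n → Fin n → Set
    sym    : ∀ i u v → Adj i u v → Adj i v u
    irrefl : ∀ i v → ¬ Adj i v v
open MLGraph public

record SGraph (n : ℕ) : Set₁ where
  field
    RAdj    : Fin n → Fin n → Set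
    rsym    : ∀ u v → RAdj u v → RAdj v u
    rirrefl : ∀ v → ¬ RAdj v v
open SGraph public

-- Multi-layer dominating sets: D ⊆ V × {1..τ}, represented as a duplicate-free list.
IsMLDominating : ∀ {n τ} → MLGraph n τ → List (Fin n × Fin τ) → Set
IsMLDominating {n} {τ} G D =
  ∀ (v : Fin n) → (∃[ i ] ((v , i) ∈ D))
                 ⊎ (∃[ w ] ∃[ i ] (((w , i) ∈ D) × Adj G i v w))

IsMLDominationNumber : ∀ {n τ} → MLGraph n τ → ℕ → Set
IsMLDominationNumber {n} {τ} G m =
  (∃[ D ] (Unique D × IsMLDominating G D × length D ≡ m))
  × (∀ (D : List (Fin n × Fin τ)) → Unique D → IsMLDominating G D → m ≤ length D)

complete : (n : ℕ) → SGraph n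
complete n = record { RAdj = λ u v → u ≢ v
                    ; rsym = λ u v p q → p (≡-sym q)
                    ; rirrefl = λ v p → p refl }

sumFin : ∀ {τ} → (Fin τ → ℕ) → ℕ
sumFin {zero}  k = 0
sumFin {suc τ} k = k fzero + sumFin (λ i → k (fsuc i))

CopPos : ∀ {n τ} → (Fin τ → ℕ) → Set
CopPos {n} {τ} k = (i : Fin τ) → Fin (k i) → Fin n

-- A deterministic cop strategy: an initial placement, and for each round t,
-- the new cop positions as a function of the robber's positions r_0..r_t
-- (the cops' own past positions are determined by the strategy itself).
record CopStrategy {n τ : ℕ} (k : Fin τ → ℕ) : Set where
  field
    start : CopPos {n} k
    next  : (t : ℕ) → (Fin (suc t) → Fin n) → CopPos {n} k
open CopStrategy public

copsAt : ∀ {n τ} {k : Fin τ → ℕ} → CopStrategy {n} k → (ℕ → Fin n) → ℕ → CopPos {n} k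
copsAt σ r zero    = start σ
copsAt σ r (suc t) = next σ t (λ j → r (toℕ j))

LegalCopMove : ∀ {n τ} → MLGraph n τ → {k : Fin τ → ℕ} → CopPos {n} k → CopPos {n} k → Set
LegalCopMove G {k} p q = ∀ i j → (q i j ≡ p i j) ⊎ Adj G i (p i j) (q i j)

LegalRobberSeq : ∀ {n} → SGraph n → (ℕ → Fin n) → Set
LegalRobberSeq R r = ∀ t → (r (suc t) ≡ r t) ⊎ RAdj R (r t) (r (suc t))

Occupies : ∀ {n τ} {k : Fin τ → ℕ} → CopPos {n} k → Fin n → Set
Occupies {k = k} p v = ∃[ i ] ∃[ j ] (p i j ≡ v)

-- Order of play: cops place c_0, robber places r_0, cops move to c_1, robber moves to r_1, ...
-- Capture checkpoints: (c_t, r_t) after the robber's turn and (c_{t+1}, r_t) after the cops' turn.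
CopsWin : ∀ {n τ} → MLGraph n τ → SGraph n → (Fin τ → ℕ) → Set
CopsWin {n} G R k =
  Σ (CopStrategy {n} k) λ σ →
    ∀ (r : ℕ → Fin n) → LegalRobberSeq R r →
      (∀ t → LegalCopMove G (copsAt σ r t) (copsAt σ r (suc t)))
      × (∃[ t ] (Occupies (copsAt σ r t) (r t) ⊎ Occupies (copsAt σ r (suc t)) (r t)))

-- "The multi-layer cop number of (G, R) is at most m": the least k such that some
-- allocation with total k wins is ≤ m, i.e. some winning allocation has total ≤ m.
CopNumberAtMost : ∀ {n τ} → MLGraph n τ → SGraph n → ℕ → Set
CopNumberAtMost {n} {τ} G R m =
  ∃[ k ] (sumFin {τ} k ≤ m × CopsWin G R k)

-- Place one cop on layer i at every vertex w with (w , i) ∈ D, so the allocation has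
-- total |D|.  Wherever the robber starts, some cop is on his vertex or dominates it
-- along its own layer; that cop steps onto him in the first cop move, before the
-- robber can move at all.
module Submission where

open import Defs
open import Data.Bool using (true; false; if_then_else_)
open import Data.Fin using (Fin; _≟_) renaming (zero to fzero; suc to fsuc)
open import Data.List using (List; []; _∷_; length; map; filter; lookup)
open import Data.List.Properties using (length-map)
open import Data.List.Membership.Propositional using (_∈_)
open import Data.List.Membership.Propositional.Properties using (∈-map⁺; ∈-filter⁺)
open import Data.List.Relation.Unary.Any using (index)
open import Data.List.Relation.Unary.Any.Properties using (lookup-index)
open import Data.Nat using (ℕ; zero; suc; _+_)
open import Data.Nat.Properties using (+-0-commutativeMonoid; ≤-reflexive)
open import Data.Product using (_×_; _,_; proj₁; proj₂)
open import Data.Product.Properties using (≡-dec)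
open import Data.Sum using (_⊎_; inj₁; inj₂)
open import Function using (_∘_)
open import Relation.Binary.PropositionalEquality using (_≡_; refl; trans; cong; cong₂; module ≡-Reasoning) renaming (sym to ≡-sym)
open import Relation.Nullary using (does; yes; no)
open import Relation.Nullary.Decidable using (dec-true)

open import Algebra.Properties.CommutativeMonoid.Sum +-0-commutativeMonoid
  using (sum; sum-cong-≗; ∑-distrib-+; sum-replicate-zero)

sumFin≡sum : ∀ {τ} (k : Fin τ → ℕ) → sumFin k ≡ sum k
sumFin≡sum {zero}  k = refl
sumFin≡sum {suc τ} k = cong (k fzero +_) (sumFin≡sum (k ∘ fsuc))

indicator : ∀ {τ} → Fin τ → Fin τ → ℕ
indicator j i = if does (j ≟ i) then 1 else 0

sum-indicator : ∀ {τ} (j : Fin τ) → sum (indicator j) ≡ 1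
sum-indicator {suc τ} fzero    = cong suc (sum-replicate-zero τ)
sum-indicator {suc τ} (fsuc j) = sum-indicator j

module _ {a} {A : Set a} {τ : ℕ} (f : A → Fin τ) where

  fibre : Fin τ → List A → List A
  fibre i = filter (λ x → f x ≟ i)

  length-fibre-∷ : ∀ x xs i → length (fibre i (x ∷ xs)) ≡ indicator (f x) i + length (fibre i xs)
  length-fibre-∷ x xs i with does (f x ≟ i)
  ... | true  = refl
  ... | false = refl

  sum-length-fibre : ∀ xs → sum (λ i → length (fibre i xs)) ≡ length xs
  sum-length-fibre []       = sum-replicate-zero τ
  sum-length-fibre (x ∷ xs) = begin
    sum (λ i → length (fibre i (x ∷ xs)))                    ≡⟨ sum-cong-≗ (length-fibre-∷ x xs) ⟩
    sum (λ i → indicator (f x) i + length (fibre i xs))      ≡⟨ ∑-distrib-+ (indicator (f x)) (λ i → length (fibre i xs)) ⟩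
    sum (indicator (f x)) + sum (λ i → length (fibre i xs))  ≡⟨ cong₂ _+_ (sum-indicator (f x)) (sum-length-fibre xs) ⟩
    suc (length xs)                                          ∎
    where open ≡-Reasoning

module _ {n τ : ℕ} (G : MLGraph n τ) (R : SGraph n) {k : Fin τ → ℕ} where

  copsWin-inOneRound : (c₀ : CopPos {n} k) (c₁ : Fin n → CopPos {n} k) →
    (∀ v → LegalCopMove G c₀ (c₁ v)) → (∀ v → Occupies c₀ v ⊎ Occupies (c₁ v) v) →
    CopsWin G R k
  copsWin-inOneRound c₀ c₁ legal capture =
    σ , λ r _ → legal-σ r , 0 , capture (r 0)
    where
    σ : CopStrategy {n} k
    σ = record { start = c₀ ; next = λ _ rs → c₁ (rs fzero) }

    legal-σ : ∀ r t → LegalCopMove G (copsAt σ r t) (copsAt σ r (suc t))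
    legal-σ r zero    = legal (r 0)
    legal-σ r (suc t) = λ _ _ → inj₁ refl

module _ {n τ : ℕ} where

  stationedOn : Fin τ → List (Fin n × Fin τ) → List (Fin n)
  stationedOn i D = map proj₁ (fibre proj₂ i D)

  allocation : List (Fin n × Fin τ) → Fin τ → ℕ
  allocation D i = length (stationedOn i D)

  sumFin-allocation : ∀ D → sumFin (allocation D) ≡ length D
  sumFin-allocation D = begin
    sumFin (allocation D)                  ≡⟨ sumFin≡sum (allocation D) ⟩
    sum (allocation D)                     ≡⟨ sum-cong-≗ (λ i → length-map proj₁ (fibre proj₂ i D)) ⟩
    sum (λ i → length (fibre proj₂ i D))   ≡⟨ sum-length-fibre proj₂ D ⟩
    length D                               ∎
    where open ≡-Reasoning

  ∈-stationedOn : ∀ {w i D} → (w , i) ∈ D → w ∈ stationedOn i D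
  ∈-stationedOn {i = i} p = ∈-map⁺ proj₁ (∈-filter⁺ (λ x → proj₂ x ≟ i) p refl)

  chase : Fin n → Fin n × Fin τ → (i : Fin τ) → Fin n → Fin n
  chase v c i w = if does (≡-dec _≟_ _≟_ (w , i) c) then v else w

  chase-self : ∀ v w i → chase v (w , i) i w ≡ v
  chase-self v w i rewrite dec-true (≡-dec _≟_ _≟_ (w , i) (w , i)) refl = refl

module _ {n τ : ℕ} (G : MLGraph n τ) (R : SGraph n)
         (D : List (Fin n × Fin τ)) (dom : IsMLDominating G D) where

  placement : CopPos {n} (allocation D)
  placement i j = lookup (stationedOn i D) j

  -- Only the cop at the dominator chosen by dom v moves; if v itself carries a cop, nobody moves.
  respond : Fin n → (i : Fin τ) → Fin n → Fin n
  respond v i w with dom v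
  ... | inj₁ _                 = w
  ... | inj₂ (w′ , i′ , _ , _) = chase v (w′ , i′) i w

  respond-legal : ∀ v i w → respond v i w ≡ w ⊎ Adj G i w (respond v i w)
  respond-legal v i w with dom v
  ... | inj₁ _ = inj₁ refl
  ... | inj₂ (w′ , i′ , _ , v~w′) with ≡-dec _≟_ _≟_ (w , i) (w′ , i′)
  ...   | yes refl = inj₂ (sym G i v w v~w′)
  ...   | no _     = inj₁ refl

  placement-at : ∀ {w i} (p : (w , i) ∈ D) → placement i (index (∈-stationedOn p)) ≡ w
  placement-at p = ≡-sym (lookup-index (∈-stationedOn p))

  respond-captures : ∀ v → Occupies placement v ⊎ Occupies (λ i j → respond v i (placement i j)) v
  respond-captures v with dom v
  ... | inj₁ (i , p)           = inj₁ (i , _ , placement-at p)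
  ... | inj₂ (w′ , i′ , p , _) =
    inj₂ (i′ , _ , trans (cong (chase v (w′ , i′) i′) (placement-at p)) (chase-self v w′ i′))

  dominating⇒copsWin : CopsWin G R (allocation D)
  dominating⇒copsWin =
    copsWin-inOneRound G R placement (λ v i j → respond v i (placement i j))
      (λ v i j → respond-legal v i (placement i j)) respond-captures

lemma5p3 : ∀ {n τ : ℕ} (G : MLGraph n τ) (m : ℕ) →
    IsMLDominationNumber G m → CopNumberAtMost G (complete n) m
lemma5p3 {n} G m ((D , _ , dom , |D|≡m) , _) =
  allocation D , ≤-reflexive (trans (sumFin-allocation D) |D|≡m) ,
  dominating⇒copsWin G (complete n) D dom
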